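{- For every $n\ge1$, $$\sum_{(S,T)} y^{b(S,T)}\,\overline{y}^{c(S,T)}=\sum_{(S,T)} y^{\#\mathsf{LL}(S,T)-1}\,\overline{y}^{\#\mathsf{RR}(S,T)-1},$$ both sums running over all intervals $(S,T)$ of $\mathbf{Tam}_n$; that is, the joint distribution of the pair (number of elements covering $T$, number of elements covered by $S$) coincides with the joint distribution of the pair (number of $\mathsf{LL}$ letters, number of $\mathsf{RR}$ letters) in the canopy word, up to the constant shift by $1$ of each count. Equivalently, $\mathbb{D}_{\mathbf{Tam}_n}(1,y,\overline{y},1)=\sum_{(S,T)} y^{\#\mathsf{LL}(S,T)-1}\overline{y}^{\#\mathsf{RR}(S,T)-1}$.
   Context: For $n\ge1$, $\mathbf{Tam}_n$ is the poset on planar binary trees with $n$ internal vertices whose covering relations are the rotations replacing a subtree $(A,(B,C))$ (internal vertex with left subtree $A$ and right subtree an internal vertex with subtrees $B,C$) by $((A,B),C)$; the order is the reflexive-transitive closure. An interval is a pair $(S,T)$ with $S\le T$; $b(S,T)$ is the number of elements covering $T$ and $c(S,T)$ the number of elements covered by $S$. The canopy of a binary tree with $n$ internal vertices is the word of length $n+1$ in $L,R$ obtained by reading the leaves left to right and writing $L$ (resp. $R$) if the leaf is a left (resp. right) child. The canopy word of an interval $(S,T)$ is the word whose $i$-th letter is the pair (i-th canopy letter of $S$, i-th canopy letter of $T$); $\#\mathsf{LL}(S,T)$ and $\#\mathsf{RR}(S,T)$ count positions where this pair is $(L,L)$, resp. $(R,R)$. For $\mathbb{D}_{\mathbf{Tam}_n}(x,y,\overline{y},\overline{x})=\sum_{(S,T)}x^ay^{b}\overline{y}^{c}\overline{x}^d$,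 with $a,d$ the numbers of covers $S\triangleleft S'\le T$ and $S\le T'\triangleleft T$. -}

module Defs where

open import Data.Nat using (ℕ; zero; suc; _+_; _∸_; _≤?_)
open import Data.Nat.Properties using () renaming (_≟_ to _≟ℕ_)
open import Data.Product using (_×_; _,_; proj₁; proj₂)
open import Data.List using (List; []; _∷_; _++_; map; concatMap; filter; length; upTo; cartesianProduct; deduplicate)
open import Data.List.Membership.DecPropositional using ()
open import Relation.Binary.PropositionalEquality using (_≡_; refl; cong₂)
open import Relation.Binary.Definitions using (Decidable)
open import Relation.Binary.Construct.Closure.ReflexiveTransitive using (Star)
open import Relation.Nullary using (Dec; yes; no; ¬_)
open import Relation.Nullary.Decidable using (_×-dec_; map′)
open import Data.Bool using (Bool; true; false)
import Data.List.Membership.DecPropositional as DecMem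

-- Planar binary trees (leaf = external vertex, node = internal vertex)

data Tree : Set where
  leaf : Tree
  node : Tree → Tree → Tree

size : Tree → ℕ
size leaf       = zero
size (node l r) = suc (size l + size r)

node-injˡ : ∀ {a b c d} → node a b ≡ node c d → a ≡ c
node-injˡ refl = refl

node-injʳ : ∀ {a b c d} → node a b ≡ node c d → b ≡ d
node-injʳ refl = refl

_≟T_ : Decidable {A = Tree} _≡_
leaf ≟T leaf = yes refl
leaf ≟T node _ _ = no λ ()
node _ _ ≟T leaf = no λ ()
node a b ≟T node c d with a ≟T c | b ≟T d
... | yes p | yes q = yes (cong₂ node p q)
... | no ¬p | _     = no λ e → ¬p (node-injˡ e)
... | yes _ | no ¬q = no λ e → ¬q (node-injʳ e)

open DecMem _≟T_ using (_∈?_) public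
open import Data.List.Membership.Propositional using (_∈_) public

treesUpTo : ℕ → List Tree
treesUpTo zero    = leaf ∷ []
treesUpTo (suc n) =
  leaf ∷ filter (λ t → size t ≤? suc n)
                (map (λ p → node (proj₁ p) (proj₂ p))
                     (cartesianProduct (treesUpTo n) (treesUpTo n)))

-- all trees with exactly n internal vertices (the elements of Tam_n)
trees : ℕ → List Tree
trees n = filter (λ t → size t ≟ℕ n) (treesUpTo n)

rotations : Tree → List Tree
rotations leaf = []
rotations (node a r) =
  root r ++ (map (λ a' → node a' r) (rotations a) ++ map (node a) (rotations r))
  where
  root : Tree → List Tree
  root leaf       = []
  root (node b c) = node (node a b) c ∷ []

_⋖_ : Tree → Tree → Set
S ⋖ T = T ∈ rotations S

_≤Tam_ : Tree → Tree → Set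
_≤Tam_ = Star _⋖_

coversAbove : ℕ → Tree → ℕ
coversAbove n T = length (deduplicate _≟T_ (filter (λ U → U ∈? rotations T) (trees n)))

coversBelow : ℕ → Tree → ℕ
coversBelow n S = length (deduplicate _≟T_ (filter (λ U → S ∈? rotations U) (trees n)))

data Dir : Set where
  L R : Dir

-- canopy: read the leaves left to right, L for a left child, R for a right child.
-- The argument records whether the current subtree is a left or right child.
canopyFrom : Dir → Tree → List Dir
canopyFrom d leaf       = d ∷ []
canopyFrom d (node l r) = canopyFrom L l ++ canopyFrom R r

canopy : Tree → List Dir
canopy leaf       = []
canopy (node l r) = canopyFrom L l ++ canopyFrom R r

isL isR : Dir → Bool
isL L = true
isL R = false
isR L = false
isR R = true

countBoth : (Dir → Bool) → List Dir → List Dir → ℕ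
countBoth p (x ∷ xs) (y ∷ ys) with p x | p y
... | true | true = suc (countBoth p xs ys)
... | _    | _    = countBoth p xs ys
countBoth p _ _ = zero

#LL #RR : Tree → Tree → ℕ
#LL S T = countBoth isL (canopy S) (canopy T)
#RR S T = countBoth isR (canopy S) (canopy T)

-- all intervals (S , T) of Tam_n, given a decision procedure for the order
-- (the result only depends on the truth value of S ≤ T)
intervals : (n : ℕ) → Decidable _≤Tam_ → List (Tree × Tree)
intervals n dec = filter (λ p → dec (proj₁ p) (proj₂ p)) (cartesianProduct (trees n) (trees n))

-- A polynomial Σ_{(a,b) ∈ xs} y^a ȳ^b in ℕ[y, ȳ] is represented by its
-- coefficient function: coeff xs i j = coefficient of y^i ȳ^j.
coeff : List (ℕ × ℕ) → ℕ → ℕ → ℕ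
coeff xs i j = length (filter (λ p → (proj₁ p ≟ℕ i) ×-dec (proj₂ p ≟ℕ j)) xs)

-- The number of trees covering T is the number of rotations applicable to T,
-- and a tree with n ≥ 1 internal vertices has exactly one more L leaf than it
-- has applicable rotations. Mirroring a tree reverses the Tamari order and
-- swaps L and R, so dually the number of trees covered by S is one less than
-- the number of R leaves of S. A rotation (A,(B,C)) ↦ ((A,B),C) changes at most
-- one canopy letter, the first letter of B, and only from L to R; hence along
-- S ≤ T the canopy moves letterwise from L to R, the LL positions of (S,T) are
-- the L letters of T and the RR positions are the R letters of S. So the two
-- statistics agree on every single interval.
module Submission where

open import Defs
open import Data.Nat using (ℕ; _≥_; _∸_; zero; suc; _+_; _≤_; _≤?_; s≤s⁻¹)
open import Data.Nat.Properties
  using (+-suc; +-assoc; +-comm; +-commutativeSemigroup; m≤m+n; m≤n+m; ≤-trans; ≤-reflexive)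
  renaming (_≟_ to _≟ℕ_)
open import Data.Product using (_,_; proj₁; proj₂; _×_; ∃-syntax)
open import Data.Sum using (_⊎_; inj₁; inj₂)
open import Data.Bool using (Bool; true; false)
open import Data.List using (List; []; _∷_; _++_; map; length; filter; deduplicate; cartesianProduct)
open import Data.List.Properties using (length-++; length-map; ++-assoc; map-cong-local)
import Data.List.Relation.Unary.All as All
open import Data.List.Relation.Unary.Any using (here; there)
open import Data.List.Relation.Binary.Pointwise as Pointwise using (Pointwise; []; _∷_)
open import Data.List.Membership.Propositional.Properties
  using (∈-++⁻; ∈-++⁺ˡ; ∈-++⁺ʳ; ∈-map⁻; ∈-map⁺; ∈-filter⁻; ∈-filter⁺;
         ∈-cartesianProduct⁺; ∈-cartesianProduct⁻; ∈-deduplicate⁻; ∈-deduplicate⁺)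
open import Data.List.Membership.Propositional.Properties.WithK using (unique∧set⇒bag)
open import Data.List.Relation.Unary.Unique.Propositional using (Unique; []; _∷_)
import Data.List.Relation.Unary.Unique.Propositional.Properties as Unique
import Data.List.Relation.Unary.Unique.DecPropositional.Properties as DecUnique
open import Data.List.Relation.Binary.BagAndSetEquality using (∼bag⇒↭)
open import Data.List.Relation.Binary.Permutation.Propositional.Properties using (↭-length)
open import Function.Bundles using (mk⇔)
open import Relation.Nullary using (¬_)
open import Relation.Binary.Construct.Closure.ReflexiveTransitive using (ε; _◅_)
open import Relation.Binary.Definitions using (Decidable; DecidableEquality; Reflexive; Transitive)
open import Relation.Binary.PropositionalEquality
  using (_≡_; _≢_; refl; sym; trans; cong; cong₂; subst; module ≡-Reasoning)
import Relation.Unary as U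
open import Algebra.Properties.CommutativeSemigroup +-commutativeSemigroup using (x∙yz≈y∙xz)

module _ {A : Set} (_≟_ : DecidableEquality A) where

  length-deduplicate-filter : ∀ {p} {P : U.Pred A p} (P? : U.Decidable P) {xs ys : List A} → Unique ys →
    (∀ {z} → P z → z ∈ ys) → (∀ {z} → z ∈ ys → z ∈ xs × P z) →
    length (deduplicate _≟_ (filter P? xs)) ≡ length ys
  length-deduplicate-filter P? {xs} {ys} ys! P⇒∈ys ∈ys⇒ =
    ↭-length (∼bag⇒↭ (unique∧set⇒bag (DecUnique.deduplicate-! _≟_ _) ys! (mk⇔ to from)))
    where
    to : ∀ {z} → z ∈ deduplicate _≟_ (filter P? xs) → z ∈ ys
    to z∈ = P⇒∈ys (proj₂ (∈-filter⁻ P? {xs = xs} (∈-deduplicate⁻ _≟_ _ z∈)))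
    from : ∀ {z} → z ∈ ys → z ∈ deduplicate _≟_ (filter P? xs)
    from z∈ys with ∈ys⇒ z∈ys
    ... | z∈xs , Pz = ∈-deduplicate⁺ _≟_ (∈-filter⁺ P? z∈xs Pz)

≢-nodeˡ : ∀ a b → a ≢ node a b
≢-nodeˡ leaf       b ()
≢-nodeˡ (node x y) b eq = ≢-nodeˡ x y (node-injˡ eq)

≢-nodeʳ : ∀ a b → b ≢ node a b
≢-nodeʳ a leaf       ()
≢-nodeʳ a (node x y) eq = ≢-nodeʳ x y (node-injʳ eq)

mirror : Tree → Tree
mirror leaf       = leaf
mirror (node l r) = node (mirror r) (mirror l)

mirror-involutive : ∀ t → mirror (mirror t) ≡ t
mirror-involutive leaf       = refl
mirror-involutive (node l r) = cong₂ node (mirror-involutive l) (mirror-involutive r)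

mirror-injective : ∀ {s t} → mirror s ≡ mirror t → s ≡ t
mirror-injective {s} {t} eq =
  trans (sym (mirror-involutive s)) (trans (cong mirror eq) (mirror-involutive t))

infix 4 _↝_

data _↝_ : Tree → Tree → Set where
  rotate : ∀ a b c → node a (node b c) ↝ node (node a b) c
  inˡ    : ∀ {a a'} r → a ↝ a' → node a r ↝ node a' r
  inʳ    : ∀ a {r r'} → r ↝ r' → node a r ↝ node a r'

-- rotations (node a r) is the root rotation (if any) followed by this list.
rotationsBelow : Tree → Tree → List Tree
rotationsBelow a r = map (λ a' → node a' r) (rotations a) ++ map (node a) (rotations r)

rotationsBelow⊆rotations : ∀ a r {U} → U ∈ rotationsBelow a r → U ∈ rotations (node a r)
rotationsBelow⊆rotations a leaf       U∈ = U∈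
rotationsBelow⊆rotations a (node b c) U∈ = there U∈

∈-rotationsBelow⁻ : ∀ a r {U} → U ∈ rotationsBelow a r →
  (∃[ a' ] a' ∈ rotations a × U ≡ node a' r) ⊎ (∃[ r' ] r' ∈ rotations r × U ≡ node a r')
∈-rotationsBelow⁻ a r U∈ with ∈-++⁻ (map (λ a' → node a' r) (rotations a)) U∈
... | inj₁ U∈ˡ = inj₁ (∈-map⁻ (λ a' → node a' r) U∈ˡ)
... | inj₂ U∈ʳ = inj₂ (∈-map⁻ (node a) U∈ʳ)

∈-rotations⁻ : ∀ t {U} → U ∈ rotations t → t ↝ U
∈-rotationsBelow⇒↝ : ∀ a r {U} → U ∈ rotationsBelow a r → node a r ↝ U

∈-rotations⁻ (node a leaf)       U∈          = ∈-rotationsBelow⇒↝ a leaf U∈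
∈-rotations⁻ (node a (node b c)) (here refl) = rotate a b c
∈-rotations⁻ (node a (node b c)) (there U∈)  = ∈-rotationsBelow⇒↝ a (node b c) U∈

∈-rotationsBelow⇒↝ a r U∈ with ∈-rotationsBelow⁻ a r U∈
... | inj₁ (a' , a'∈ , refl) = inˡ r (∈-rotations⁻ a a'∈)
... | inj₂ (r' , r'∈ , refl) = inʳ a (∈-rotations⁻ r r'∈)

∈-rotations⁺ : ∀ {t U} → t ↝ U → U ∈ rotations t
∈-rotations⁺ (rotate a b c) = here refl
∈-rotations⁺ (inˡ {a} r a↝a') =
  rotationsBelow⊆rotations a r (∈-++⁺ˡ (∈-map⁺ (λ x → node x r) (∈-rotations⁺ a↝a')))
∈-rotations⁺ (inʳ a {r} r↝r') =
  rotationsBelow⊆rotations a r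
    (∈-++⁺ʳ (map (λ x → node x r) (rotations a)) (∈-map⁺ (node a) (∈-rotations⁺ r↝r')))

↝-irrefl : ∀ {t U} → t ↝ U → U ≢ t
↝-irrefl (rotate a b c) eq = ≢-nodeˡ a b (sym (node-injˡ eq))
↝-irrefl (inˡ r a↝a')  eq = ↝-irrefl a↝a' (node-injˡ eq)
↝-irrefl (inʳ a r↝r')  eq = ↝-irrefl r↝r' (node-injʳ eq)

↝-size : ∀ {t U} → t ↝ U → size U ≡ size t
↝-size (rotate a b c) =
  cong suc (trans (cong suc (+-assoc (size a) (size b) (size c))) (sym (+-suc (size a) (size b + size c))))
↝-size (inˡ r a↝a') = cong (λ k → suc (k + size r)) (↝-size a↝a')
↝-size (inʳ a r↝r') = cong (λ k → suc (size a + k)) (↝-size r↝r')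

↝-mirror : ∀ {t U} → t ↝ U → mirror U ↝ mirror t
↝-mirror (rotate a b c) = rotate (mirror c) (mirror b) (mirror a)
↝-mirror (inˡ r a↝a')  = inʳ (mirror r) (↝-mirror a↝a')
↝-mirror (inʳ a r↝r')  = inˡ (mirror a) (↝-mirror r↝r')

rotationsBelow-unique : ∀ a r → Unique (rotations a) → Unique (rotations r) →
  Unique (rotationsBelow a r)
rotationsBelow-unique a r a! r! =
  Unique.++⁺ (Unique.map⁺ node-injˡ a!) (Unique.map⁺ node-injʳ r!) disjoint
  where
  disjoint : ∀ {U} → ¬ (U ∈ map (λ a' → node a' r) (rotations a) × U ∈ map (node a) (rotations r))
  disjoint (U∈ˡ , U∈ʳ) with ∈-map⁻ _ U∈ˡ | ∈-map⁻ _ U∈ʳ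
  ... | a' , a'∈ , refl | _ , _ , eq = ↝-irrefl (∈-rotations⁻ a a'∈) (node-injˡ eq)

rotations-unique : ∀ t → Unique (rotations t)
rotations-unique leaf = []
rotations-unique (node a leaf) =
  rotationsBelow-unique a leaf (rotations-unique a) []
rotations-unique (node a (node b c)) =
  All.tabulate root∉below ∷ rotationsBelow-unique a (node b c) (rotations-unique a) (rotations-unique (node b c))
  where
  root∉below : ∀ {U} → U ∈ rotationsBelow a (node b c) → node (node a b) c ≢ U
  root∉below U∈ with ∈-rotationsBelow⁻ a (node b c) U∈
  ... | inj₁ (_ , _ , refl) = λ eq → ≢-nodeʳ b c (node-injʳ eq)
  ... | inj₂ (_ , _ , refl) = λ eq → ≢-nodeˡ a b (sym (node-injˡ eq))

treesUpTo-complete : ∀ n t → size t ≤ n → t ∈ treesUpTo n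
treesUpTo-complete zero    leaf       _  = here refl
treesUpTo-complete (suc n) leaf       _  = here refl
treesUpTo-complete (suc n) (node l r) le =
  there (∈-filter⁺ (λ t → size t ≤? suc n)
    (∈-map⁺ (λ p → node (proj₁ p) (proj₂ p))
      (∈-cartesianProduct⁺ (treesUpTo-complete n l (≤-trans (m≤m+n (size l) (size r)) (s≤s⁻¹ le)))
                           (treesUpTo-complete n r (≤-trans (m≤n+m (size r) (size l)) (s≤s⁻¹ le)))))
    le)

∈-trees⁺ : ∀ {n t} → size t ≡ n → t ∈ trees n
∈-trees⁺ {n} {t} eq = ∈-filter⁺ (λ t → size t ≟ℕ n) (treesUpTo-complete n t (≤-reflexive eq)) eq

∈-trees⁻ : ∀ {n t} → t ∈ trees n → size t ≡ n
∈-trees⁻ {n} t∈ = proj₂ (∈-filter⁻ (λ t → size t ≟ℕ n) {xs = treesUpTo n} t∈)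

coversAbove≡length-rotations : ∀ {n T} → size T ≡ n → coversAbove n T ≡ length (rotations T)
coversAbove≡length-rotations {n} {T} sizeT =
  length-deduplicate-filter _≟T_ (λ U → U ∈? rotations T) (rotations-unique T) (λ U∈ → U∈)
    (λ U∈ → ∈-trees⁺ (trans (↝-size (∈-rotations⁻ T U∈)) sizeT) , U∈)

-- Trees covered by S are the mirror images of the trees covering mirror S.
coversBelow≡length-rotations-mirror : ∀ {n S} → size S ≡ n →
  coversBelow n S ≡ length (rotations (mirror S))
coversBelow≡length-rotations-mirror {n} {S} sizeS = begin
  coversBelow n S
    ≡⟨ length-deduplicate-filter _≟T_ (λ U → S ∈? rotations U)
         (Unique.map⁺ mirror-injective (rotations-unique (mirror S))) to from ⟩
  length (map mirror (rotations (mirror S)))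
    ≡⟨ length-map mirror (rotations (mirror S)) ⟩
  length (rotations (mirror S)) ∎
  where
  open ≡-Reasoning
  to : ∀ {U} → S ∈ rotations U → U ∈ map mirror (rotations (mirror S))
  to {U} S∈ = subst (_∈ map mirror (rotations (mirror S))) (mirror-involutive U)
    (∈-map⁺ mirror (∈-rotations⁺ (↝-mirror (∈-rotations⁻ U S∈))))
  from : ∀ {U} → U ∈ map mirror (rotations (mirror S)) → U ∈ trees n × S ∈ rotations U
  from U∈ with ∈-map⁻ mirror U∈
  ... | W , W∈ , refl =
    ∈-trees⁺ (trans (sym (↝-size U↝S)) sizeS) , ∈-rotations⁺ U↝S
    where
    U↝S : mirror W ↝ S
    U↝S = subst (mirror W ↝_) (mirror-involutive S) (↝-mirror (∈-rotations⁻ (mirror S) W∈))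

count : (Dir → Bool) → List Dir → ℕ
count p [] = zero
count p (x ∷ xs) with p x
... | true  = suc (count p xs)
... | false = count p xs

count-++ : ∀ p xs ys → count p (xs ++ ys) ≡ count p xs + count p ys
count-++ p []       ys = refl
count-++ p (x ∷ xs) ys with p x
... | true  = cong suc (count-++ p xs ys)
... | false = count-++ p xs ys

isNode : Tree → ℕ
isNode leaf       = zero
isNode (node _ _) = suc zero

length-rotationsBelow : ∀ a r →
  length (rotationsBelow a r) ≡ length (rotations a) + length (rotations r)
length-rotationsBelow a r = trans (length-++ (map (λ a' → node a' r) (rotations a)))
  (cong₂ _+_ (length-map (λ a' → node a' r) (rotations a)) (length-map (node a) (rotations r)))

length-rotations-node : ∀ a r →
  length (rotations (node a r)) ≡ isNode r + (length (rotations a) + length (rotations r))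
length-rotations-node a leaf       = length-rotationsBelow a leaf
length-rotations-node a (node b c) = cong suc (length-rotationsBelow a (node b c))

count-isL-canopyFrom-L : ∀ t → count isL (canopyFrom L t) ≡ suc (length (rotations t))
count-isL-canopyFrom-R : ∀ t → count isL (canopyFrom R t) ≡ isNode t + length (rotations t)

count-isL-canopyFrom-L leaf       = refl
count-isL-canopyFrom-L (node a r) = begin
  count isL (canopyFrom L a ++ canopyFrom R r)
    ≡⟨ count-++ isL (canopyFrom L a) (canopyFrom R r) ⟩
  count isL (canopyFrom L a) + count isL (canopyFrom R r)
    ≡⟨ cong₂ _+_ (count-isL-canopyFrom-L a) (count-isL-canopyFrom-R r) ⟩
  suc (length (rotations a) + (isNode r + length (rotations r)))
    ≡⟨ cong suc (x∙yz≈y∙xz (length (rotations a)) (isNode r) (length (rotations r))) ⟩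
  suc (isNode r + (length (rotations a) + length (rotations r)))
    ≡⟨ cong suc (sym (length-rotations-node a r)) ⟩
  suc (length (rotations (node a r))) ∎
  where open ≡-Reasoning
count-isL-canopyFrom-R leaf       = refl
count-isL-canopyFrom-R (node a r) = count-isL-canopyFrom-L (node a r)

opposite : Dir → Dir
opposite L = R
opposite R = L

count-isR-canopyFrom : ∀ d t → count isR (canopyFrom d t) ≡ count isL (canopyFrom (opposite d) (mirror t))
count-isR-canopyFrom L leaf       = refl
count-isR-canopyFrom R leaf       = refl
count-isR-canopyFrom d (node l r) = begin
  count isR (canopyFrom L l ++ canopyFrom R r)
    ≡⟨ count-++ isR (canopyFrom L l) (canopyFrom R r) ⟩
  count isR (canopyFrom L l) + count isR (canopyFrom R r)
    ≡⟨ cong₂ _+_ (count-isR-canopyFrom L l) (count-isR-canopyFrom R r) ⟩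
  count isL (canopyFrom R (mirror l)) + count isL (canopyFrom L (mirror r))
    ≡⟨ +-comm (count isL (canopyFrom R (mirror l))) _ ⟩
  count isL (canopyFrom L (mirror r)) + count isL (canopyFrom R (mirror l))
    ≡⟨ count-++ isL (canopyFrom L (mirror r)) (canopyFrom R (mirror l)) ⟨
  count isL (canopyFrom L (mirror r) ++ canopyFrom R (mirror l)) ∎
  where open ≡-Reasoning

count-isR-canopy : ∀ l r → count isR (canopy (node l r)) ≡ suc (length (rotations (mirror (node l r))))
count-isR-canopy l r =
  trans (count-isR-canopyFrom L (node l r)) (count-isL-canopyFrom-R (mirror (node l r)))

infix 4 _⊑_

data _⊑_ : Dir → Dir → Set where
  L⊑L : L ⊑ L
  L⊑R : L ⊑ R
  R⊑R : R ⊑ R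

⊑-refl : Reflexive _⊑_
⊑-refl {L} = L⊑L
⊑-refl {R} = R⊑R

⊑-trans : Transitive _⊑_
⊑-trans L⊑L q   = q
⊑-trans L⊑R R⊑R = L⊑R
⊑-trans R⊑R R⊑R = R⊑R

⊑*-refl : ∀ xs → Pointwise _⊑_ xs xs
⊑*-refl xs = Pointwise.refl ⊑-refl {xs}

canopyFrom-L⊑R : ∀ t → Pointwise _⊑_ (canopyFrom L t) (canopyFrom R t)
canopyFrom-L⊑R leaf       = L⊑R ∷ []
canopyFrom-L⊑R (node _ _) = ⊑*-refl _

↝-canopyFrom : ∀ d {t U} → t ↝ U → Pointwise _⊑_ (canopyFrom d t) (canopyFrom d U)
↝-canopyFrom d (rotate a b c) =
  subst (Pointwise _⊑_ _) (sym (++-assoc (canopyFrom L a) (canopyFrom R b) (canopyFrom R c)))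
    (Pointwise.++⁺ (⊑*-refl (canopyFrom L a)) (Pointwise.++⁺ (canopyFrom-L⊑R b) (⊑*-refl (canopyFrom R c))))
↝-canopyFrom d (inˡ r a↝a') = Pointwise.++⁺ (↝-canopyFrom L a↝a') (⊑*-refl _)
↝-canopyFrom d (inʳ a r↝r') = Pointwise.++⁺ (⊑*-refl _) (↝-canopyFrom R r↝r')

-- canopy and canopyFrom L differ only on a leaf, so the rotation is matched to expose nodes.
↝-canopy : ∀ {t U} → t ↝ U → Pointwise _⊑_ (canopy t) (canopy U)
↝-canopy t↝U@(rotate _ _ _) = ↝-canopyFrom L t↝U
↝-canopy t↝U@(inˡ _ _)      = ↝-canopyFrom L t↝U
↝-canopy t↝U@(inʳ _ _)      = ↝-canopyFrom L t↝U

≤Tam-canopy : ∀ {S T} → S ≤Tam T → Pointwise _⊑_ (canopy S) (canopy T)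
≤Tam-canopy ε = ⊑*-refl _
≤Tam-canopy {S} (S⋖U ◅ U≤T) =
  Pointwise.transitive ⊑-trans (↝-canopy (∈-rotations⁻ S S⋖U)) (≤Tam-canopy U≤T)

countBoth-isL : ∀ {xs ys} → Pointwise _⊑_ xs ys → countBoth isL xs ys ≡ count isL ys
countBoth-isL []          = refl
countBoth-isL (L⊑L ∷ x⊑y) = cong suc (countBoth-isL x⊑y)
countBoth-isL (L⊑R ∷ x⊑y) = countBoth-isL x⊑y
countBoth-isL (R⊑R ∷ x⊑y) = countBoth-isL x⊑y

countBoth-isR : ∀ {xs ys} → Pointwise _⊑_ xs ys → countBoth isR xs ys ≡ count isR xs
countBoth-isR []          = refl
countBoth-isR (L⊑L ∷ x⊑y) = countBoth-isR x⊑y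
countBoth-isR (L⊑R ∷ x⊑y) = countBoth-isR x⊑y
countBoth-isR (R⊑R ∷ x⊑y) = cong suc (countBoth-isR x⊑y)

#LL∸1≡length-rotations : ∀ {S T} → size T ≥ 1 → S ≤Tam T → #LL S T ∸ 1 ≡ length (rotations T)
#LL∸1≡length-rotations {T = node a r} _ S≤T =
  cong (_∸ 1) (trans (countBoth-isL (≤Tam-canopy S≤T)) (count-isL-canopyFrom-L (node a r)))

#RR∸1≡length-rotations-mirror : ∀ {S T} → size S ≥ 1 → S ≤Tam T →
  #RR S T ∸ 1 ≡ length (rotations (mirror S))
#RR∸1≡length-rotations-mirror {node l r} _ S≤T =
  cong (_∸ 1) (trans (countBoth-isR (≤Tam-canopy S≤T)) (count-isR-canopy l r))

coverCounts≡canopyCounts : ∀ n → n ≥ 1 → (dec : Decidable _≤Tam_) → ∀ {S T} → (S , T) ∈ intervals n dec →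
  (coversAbove n T , coversBelow n S) ≡ (#LL S T ∸ 1 , #RR S T ∸ 1)
coverCounts≡canopyCounts n n≥1 dec ST∈
  with ∈-filter⁻ (λ p → dec (proj₁ p) (proj₂ p)) {xs = cartesianProduct (trees n) (trees n)} ST∈
... | ST∈² , S≤T with ∈-cartesianProduct⁻ (trees n) (trees n) ST∈²
... | S∈ , T∈ = cong₂ _,_
  (trans (coversAbove≡length-rotations (∈-trees⁻ {n} T∈))
         (sym (#LL∸1≡length-rotations (subst (_≥ 1) (sym (∈-trees⁻ {n} T∈)) n≥1) S≤T)))
  (trans (coversBelow≡length-rotations-mirror (∈-trees⁻ {n} S∈))
         (sym (#RR∸1≡length-rotations-mirror (subst (_≥ 1) (sym (∈-trees⁻ {n} S∈)) n≥1) S≤T)))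

proposition4 : (n : ℕ) → n ≥ 1 → (dec : Decidable _≤Tam_) → (i j : ℕ) →
  coeff (map (λ p → coversAbove n (proj₂ p) , coversBelow n (proj₁ p)) (intervals n dec)) i j
    ≡ coeff (map (λ p → #LL (proj₁ p) (proj₂ p) ∸ 1 , #RR (proj₁ p) (proj₂ p) ∸ 1) (intervals n dec)) i j
proposition4 n n≥1 dec i j =
  cong (λ xs → coeff xs i j)
       (map-cong-local {xs = intervals n dec} (All.tabulate λ {(S , T)} → coverCounts≡canopyCounts n n≥1 dec))
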